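{- Let $\mathcal{C}$ be a $\mathsf{Pos}$-category with comma and cocomma objects, and $A,B$ objects of $\mathcal{C}$. Then the $\mathsf{Pos}$-functors $\mathit{Cocomma}:\mathsf{Span}(A,B)\to\mathsf{Cospan}(A,B)$ and $\mathit{Comma}:\mathsf{Cospan}(A,B)\to\mathsf{Span}(A,B)$ satisfy $\mathit{Cocomma}\dashv\mathit{Comma}$, and the induced monad and comonad are idempotent. Restricting to skeletons of $\mathsf{Span}(A,B)$ and $\mathsf{Cospan}(A,B)$, $\mathit{Comma}\circ\mathit{Cocomma}$ is a closure operator and $\mathit{Cocomma}\circ\mathit{Comma}$ is an interior operator, and there is a bijection between the fixed points of $\mathit{Comma}\circ\mathit{Cocomma}$ and the fixed points of $\mathit{Cocomma}\circ\mathit{Comma}$. Furthermore, if $\mathcal{C}=\mathsf{Pos}$, these fixed points are in bijection with the weakening relations $A\looparrowright B$.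
   Context: A $\mathsf{Pos}$-category is a category whose homsets are posets with monotone composition. Given a cospan $A\xrightarrow{j}C\xleftarrow{k}B$, its comma object is a span $A\xleftarrow{p}W\xrightarrow{q}B$ with $jp\le kq$ such that for every span $(p',q')$ from $X$ with $jp'\le kq'$ there is a unique $h:X\to W$ with $ph=p'$, $qh=q'$, and such that this is monotone: if $p_1\le p_2$ and $q_1\le q_2$ then $h_1\le h_2$. A cocomma of a span is a comma in $\mathcal{C}^{\mathrm{op}}$. $\mathsf{Span}(A,B)$ has spans $(p:W\to A,q:W\to B)$ as objects and as arrows $(p,q)\to(p',q')$ the $f:W\to W'$ with $p'f=p$, $q'f=q$ (ordered as in $\mathcal{C}$); $\mathsf{Cospan}(A,B)$ is defined dually. $\mathit{Comma}$ sends a cospan to its comma span and $\mathit{Cocomma}$ sends a span to its cocomma cospan. A weakening relation $A\looparrowright B$ between posets is a subset $R\subseteq A\times B$ with $a'\le aRb\le b'\Rightarrow a'Rb'$. -}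

module Defs where

open import Level using (Level; _⊔_) renaming (suc to lsuc)
open import Data.Product using (Σ; _×_; _,_; proj₁; proj₂; swap)
open import Relation.Binary.Bundles using (Poset)

-- Equality of parallel arrows is the symmetrisation of the hom-order,
-- so each hom-set is a poset (antisymmetric up to this equality).

Sym : ∀ {a r} {X : Set a} → (X → X → Set r) → X → X → Set r
Sym R x y = R x y × R y x

record PosCat (o ℓ e : Level) : Set (lsuc (o ⊔ ℓ ⊔ e)) where
  infixr 9 _∘_
  infix 4 _≤_
  field
    Obj : Set o
    _⇒_ : Obj → Obj → Set ℓ
    _≤_ : ∀ {A B} → A ⇒ B → A ⇒ B → Set e
    ≤-refl : ∀ {A B} {f : A ⇒ B} → f ≤ f
    ≤-trans : ∀ {A B} {f g h : A ⇒ B} → f ≤ g → g ≤ h → f ≤ h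
    id : ∀ {A} → A ⇒ A
    _∘_ : ∀ {A B C} → B ⇒ C → A ⇒ B → A ⇒ C
    ∘-mono : ∀ {A B C} {f f' : B ⇒ C} {g g' : A ⇒ B} →
             f ≤ f' → g ≤ g' → f ∘ g ≤ f' ∘ g'
    identityˡ : ∀ {A B} {f : A ⇒ B} → Sym _≤_ (id ∘ f) f
    identityʳ : ∀ {A B} {f : A ⇒ B} → Sym _≤_ (f ∘ id) f
    assoc : ∀ {A B C D} {f : C ⇒ D} {g : B ⇒ C} {h : A ⇒ B} →
            Sym _≤_ ((f ∘ g) ∘ h) (f ∘ (g ∘ h))

  infix 4 _≈_
  _≈_ : ∀ {A B} → A ⇒ B → A ⇒ B → Set e
  _≈_ = Sym _≤_

module PosCatProps {o ℓ e} (C : PosCat o ℓ e) where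
  open PosCat C

  ≈-refl : ∀ {A B} {f : A ⇒ B} → f ≈ f
  ≈-refl = ≤-refl , ≤-refl

  ≈-sym : ∀ {A B} {f g : A ⇒ B} → f ≈ g → g ≈ f
  ≈-sym (a , b) = b , a

  ≈-trans : ∀ {A B} {f g h : A ⇒ B} → f ≈ g → g ≈ h → f ≈ h
  ≈-trans (a , b) (c , d) = ≤-trans a c , ≤-trans d b

  ∘-resp-≈ : ∀ {A B C} {f f' : B ⇒ C} {g g' : A ⇒ B} →
             f ≈ f' → g ≈ g' → f ∘ g ≈ f' ∘ g'
  ∘-resp-≈ (a , b) (c , d) = ∘-mono a c , ∘-mono b d

op : ∀ {o ℓ e} → PosCat o ℓ e → PosCat o ℓ e
op C = record
  { Obj = Obj
  ; _⇒_ = λ A B → B ⇒ A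
  ; _≤_ = _≤_
  ; ≤-refl = ≤-refl
  ; ≤-trans = ≤-trans
  ; id = id
  ; _∘_ = λ f g → g ∘ f
  ; ∘-mono = λ p q → ∘-mono q p
  ; identityˡ = identityʳ
  ; identityʳ = identityˡ
  ; assoc = swap assoc
  }
  where open PosCat C

module _ {o ℓ e} (C : PosCat o ℓ e) where
  open PosCat C

  record IsIso {A B : Obj} (f : A ⇒ B) : Set (ℓ ⊔ e) where
    field
      inv : B ⇒ A
      isoˡ : inv ∘ f ≈ id
      isoʳ : f ∘ inv ≈ id

  record Iso (A B : Obj) : Set (ℓ ⊔ e) where
    field
      to : A ⇒ B
      isIso : IsIso to

module _ {o ℓ e} (C : PosCat o ℓ e) where
  open PosCat C

  record IsComma {A B X : Obj} (j : A ⇒ X) (k : B ⇒ X)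
                 {W : Obj} (p : W ⇒ A) (q : W ⇒ B) : Set (o ⊔ ℓ ⊔ e) where
    field
      comm : j ∘ p ≤ k ∘ q
      med : ∀ {Y} (p' : Y ⇒ A) (q' : Y ⇒ B) → j ∘ p' ≤ k ∘ q' → Y ⇒ W
      med-p : ∀ {Y} {p' : Y ⇒ A} {q' : Y ⇒ B} (c : j ∘ p' ≤ k ∘ q') →
              p ∘ med p' q' c ≈ p'
      med-q : ∀ {Y} {p' : Y ⇒ A} {q' : Y ⇒ B} (c : j ∘ p' ≤ k ∘ q') →
              q ∘ med p' q' c ≈ q'
      unique : ∀ {Y} {p' : Y ⇒ A} {q' : Y ⇒ B} (c : j ∘ p' ≤ k ∘ q') (h : Y ⇒ W) →
               p ∘ h ≈ p' → q ∘ h ≈ q' → h ≈ med p' q' c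
      monotone : ∀ {Y} {p₁ p₂ : Y ⇒ A} {q₁ q₂ : Y ⇒ B}
                 (c₁ : j ∘ p₁ ≤ k ∘ q₁) (c₂ : j ∘ p₂ ≤ k ∘ q₂) →
                 p₁ ≤ p₂ → q₁ ≤ q₂ → med p₁ q₁ c₁ ≤ med p₂ q₂ c₂

  record CommaObj {A B X : Obj} (j : A ⇒ X) (k : B ⇒ X) : Set (o ⊔ ℓ ⊔ e) where
    field
      W : Obj
      p : W ⇒ A
      q : W ⇒ B
      isComma : IsComma j k p q

  HasCommas : Set (o ⊔ ℓ ⊔ e)
  HasCommas = ∀ {A B X : Obj} (j : A ⇒ X) (k : B ⇒ X) → CommaObj j k

HasCocommas : ∀ {o ℓ e} → PosCat o ℓ e → Set (o ⊔ ℓ ⊔ e)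
HasCocommas C = HasCommas (op C)

module _ {o ℓ e} (C : PosCat o ℓ e) where
  open PosCat C
  open PosCatProps C

  record SpanObj (A B : Obj) : Set (o ⊔ ℓ) where
    constructor mkSpan
    field
      apex : Obj
      left : apex ⇒ A
      right : apex ⇒ B

  record SpanHom {A B : Obj} (S T : SpanObj A B) : Set (ℓ ⊔ e) where
    open SpanObj
    field
      arr : apex S ⇒ apex T
      left-eq : left T ∘ arr ≈ left S
      right-eq : right T ∘ arr ≈ right S

  record CospanObj (A B : Obj) : Set (o ⊔ ℓ) where
    constructor mkCospan
    field
      apex : Obj
      inl : A ⇒ apex
      inr : B ⇒ apex

  record CospanHom {A B : Obj} (S T : CospanObj A B) : Set (ℓ ⊔ e) where
    open CospanObj
    field
      arr : apex S ⇒ apex T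
      inl-eq : arr ∘ inl S ≈ inl T
      inr-eq : arr ∘ inr S ≈ inr T

  private
    shuffleˡ : ∀ {X Y Z V} {l : Y ⇒ V} {f : Z ⇒ Y} {g : X ⇒ Z} {m : Z ⇒ V} {n : X ⇒ V} →
               l ∘ f ≈ m → m ∘ g ≈ n → l ∘ (f ∘ g) ≈ n
    shuffleˡ e1 e2 = ≈-trans (≈-sym assoc) (≈-trans (∘-resp-≈ e1 ≈-refl) e2)

    shuffleʳ : ∀ {X Y Z V} {l : Y ⇒ V} {f : Z ⇒ Y} {g : X ⇒ Z} {m : X ⇒ Y} {n : X ⇒ V} →
               f ∘ g ≈ m → l ∘ m ≈ n → (l ∘ f) ∘ g ≈ n
    shuffleʳ e1 e2 = ≈-trans assoc (≈-trans (∘-resp-≈ ≈-refl e1) e2)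

  Span : (A B : Obj) → PosCat (o ⊔ ℓ) (ℓ ⊔ e) e
  Span A B = record
    { Obj = SpanObj A B
    ; _⇒_ = SpanHom
    ; _≤_ = λ f g → SpanHom.arr f ≤ SpanHom.arr g
    ; ≤-refl = ≤-refl
    ; ≤-trans = ≤-trans
    ; id = record { arr = id ; left-eq = identityʳ ; right-eq = identityʳ }
    ; _∘_ = λ f g → record
        { arr = SpanHom.arr f ∘ SpanHom.arr g
        ; left-eq = shuffleˡ (SpanHom.left-eq f) (SpanHom.left-eq g)
        ; right-eq = shuffleˡ (SpanHom.right-eq f) (SpanHom.right-eq g) }
    ; ∘-mono = ∘-mono
    ; identityˡ = identityˡ
    ; identityʳ = identityʳ
    ; assoc = assoc
    }

  Cospan : (A B : Obj) → PosCat (o ⊔ ℓ) (ℓ ⊔ e) e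
  Cospan A B = record
    { Obj = CospanObj A B
    ; _⇒_ = CospanHom
    ; _≤_ = λ f g → CospanHom.arr f ≤ CospanHom.arr g
    ; ≤-refl = ≤-refl
    ; ≤-trans = ≤-trans
    ; id = record { arr = id ; inl-eq = identityˡ ; inr-eq = identityˡ }
    ; _∘_ = λ f g → record
        { arr = CospanHom.arr f ∘ CospanHom.arr g
        ; inl-eq = shuffleʳ (CospanHom.inl-eq g) (CospanHom.inl-eq f)
        ; inr-eq = shuffleʳ (CospanHom.inr-eq g) (CospanHom.inr-eq f) }
    ; ∘-mono = ∘-mono
    ; identityˡ = identityˡ
    ; identityʳ = identityʳ
    ; assoc = assoc
    }

record RawFunctor {o ℓ e o' ℓ' e'} (C : PosCat o ℓ e) (D : PosCat o' ℓ' e')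
       : Set (o ⊔ ℓ ⊔ o' ⊔ ℓ') where
  private
    module C = PosCat C
    module D = PosCat D
  field
    F₀ : C.Obj → D.Obj
    F₁ : ∀ {X Y} → X C.⇒ Y → F₀ X D.⇒ F₀ Y

module _ {o ℓ e o' ℓ' e'} {C : PosCat o ℓ e} {D : PosCat o' ℓ' e'} where
  private
    module C = PosCat C
    module D = PosCat D

  record IsPosFunctor (F : RawFunctor C D) : Set (o ⊔ ℓ ⊔ e ⊔ e') where
    open RawFunctor F
    field
      F-id : ∀ {X} → F₁ (C.id {X}) D.≈ D.id
      F-∘ : ∀ {X Y Z} (f : Y C.⇒ Z) (g : X C.⇒ Y) → F₁ (f C.∘ g) D.≈ F₁ f D.∘ F₁ g
      F-mono : ∀ {X Y} {f g : X C.⇒ Y} → f C.≤ g → F₁ f D.≤ F₁ g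

  record Adjunction (F : RawFunctor C D) (G : RawFunctor D C) : Set (o ⊔ ℓ ⊔ e ⊔ o' ⊔ ℓ' ⊔ e') where
    private
      module F = RawFunctor F
      module G = RawFunctor G
    field
      η : ∀ X → X C.⇒ G.F₀ (F.F₀ X)
      ε : ∀ Y → F.F₀ (G.F₀ Y) D.⇒ Y
      η-nat : ∀ {X X'} (f : X C.⇒ X') → G.F₁ (F.F₁ f) C.∘ η X C.≈ η X' C.∘ f
      ε-nat : ∀ {Y Y'} (g : Y D.⇒ Y') → g D.∘ ε Y D.≈ ε Y' D.∘ F.F₁ (G.F₁ g)
      zig : ∀ X → ε (F.F₀ X) D.∘ F.F₁ (η X) D.≈ D.id
      zag : ∀ Y → G.F₁ (ε Y) C.∘ η (G.F₀ Y) C.≈ C.id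

    μ : ∀ X → G.F₀ (F.F₀ (G.F₀ (F.F₀ X))) C.⇒ G.F₀ (F.F₀ X)
    μ X = G.F₁ (ε (F.F₀ X))

    δ : ∀ Y → F.F₀ (G.F₀ Y) D.⇒ F.F₀ (G.F₀ (F.F₀ (G.F₀ Y)))
    δ Y = F.F₁ (η (G.F₀ Y))

  IdempotentMonad : {F : RawFunctor C D} {G : RawFunctor D C} → Adjunction F G → Set (ℓ ⊔ e ⊔ o)
  IdempotentMonad adj = ∀ X → IsIso C (Adjunction.μ adj X)

  IdempotentComonad : {F : RawFunctor C D} {G : RawFunctor D C} → Adjunction F G → Set (ℓ' ⊔ e' ⊔ o')
  IdempotentComonad adj = ∀ Y → IsIso D (Adjunction.δ adj Y)

_∘F_ : ∀ {o ℓ e o' ℓ' e' o'' ℓ'' e''} {C : PosCat o ℓ e} {D : PosCat o' ℓ' e'}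
         {E : PosCat o'' ℓ'' e''} → RawFunctor D E → RawFunctor C D → RawFunctor C E
G ∘F F = record { F₀ = λ X → G.F₀ (F.F₀ X) ; F₁ = λ f → G.F₁ (F.F₁ f) }
  where
    module F = RawFunctor F
    module G = RawFunctor G

-- Closure / interior operators on the skeleton of a Pos-category.
-- Objects of the skeleton are objects up to isomorphism, so equality in
-- the skeleton is rendered as  Iso .

module _ {o ℓ e} (C : PosCat o ℓ e) where
  open PosCat C

  record ClosureOp (T : RawFunctor C C) : Set (o ⊔ ℓ ⊔ e) where
    open RawFunctor T
    field
      monotone : IsPosFunctor T
      extensive : ∀ X → X ⇒ F₀ X
      idempotent : ∀ X → Iso C (F₀ (F₀ X)) (F₀ X)

  record InteriorOp (T : RawFunctor C C) : Set (o ⊔ ℓ ⊔ e) where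
    open RawFunctor T
    field
      monotone : IsPosFunctor T
      deflationary : ∀ X → F₀ X ⇒ X
      idempotent : ∀ X → Iso C (F₀ (F₀ X)) (F₀ X)

  Fix : RawFunctor C C → Set (o ⊔ ℓ ⊔ e)
  Fix T = Σ Obj (λ X → Iso C (RawFunctor.F₀ T X) X)

  FixIso : (T : RawFunctor C C) → Fix T → Fix T → Set (ℓ ⊔ e)
  FixIso T x y = Iso C (proj₁ x) (proj₁ y)

-- A bijection between two types each taken modulo an equivalence relation
-- (i.e. between the corresponding quotient sets).
record Bij {a b r s} (X : Set a) (_~_ : X → X → Set r)
                     (Y : Set b) (_∼_ : Y → Y → Set s) : Set (a ⊔ b ⊔ r ⊔ s) where
  field
    to : X → Y
    from : Y → X
    to-cong : ∀ {x x'} → x ~ x' → to x ∼ to x'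
    from-cong : ∀ {y y'} → y ∼ y' → from y ~ from y'
    from-to : ∀ x → from (to x) ~ x
    to-from : ∀ y → to (from y) ∼ y

module _ {o ℓ e} (C : PosCat o ℓ e) where
  open PosCat C
  open PosCatProps C

  private
    sandwich : ∀ {X Y} {f f' g' g : X ⇒ Y} → f ≈ f' → f' ≤ g' → g' ≈ g → f ≤ g
    sandwich (a , _) b (c , _) = ≤-trans a (≤-trans b c)

  CommaF : HasCommas C → (A B : Obj) → RawFunctor (Cospan C A B) (Span C A B)
  CommaF cm A B = record { F₀ = F₀ ; F₁ = F₁ }
    where
      F₀ : CospanObj C A B → SpanObj C A B
      F₀ K = mkSpan (CommaObj.W c) (CommaObj.p c) (CommaObj.q c)
        where c = cm (CospanObj.inl K) (CospanObj.inr K)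

      F₁ : ∀ {K K'} → CospanHom C K K' → SpanHom C (F₀ K) (F₀ K')
      F₁ {K} {K'} g = record
        { arr = IsComma.med ic' p q cond
        ; left-eq = IsComma.med-p ic' cond
        ; right-eq = IsComma.med-q ic' cond }
        where
          c = cm (CospanObj.inl K) (CospanObj.inr K)
          c' = cm (CospanObj.inl K') (CospanObj.inr K')
          ic' = CommaObj.isComma c'
          p = CommaObj.p c
          q = CommaObj.q c
          cond : CospanObj.inl K' ∘ p ≤ CospanObj.inr K' ∘ q
          cond = sandwich
            (≈-trans (∘-resp-≈ (≈-sym (CospanHom.inl-eq g)) ≈-refl) assoc)
            (∘-mono ≤-refl (IsComma.comm (CommaObj.isComma c)))
            (≈-trans (≈-sym assoc) (∘-resp-≈ (CospanHom.inr-eq g) ≈-refl))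

  CocommaF : HasCocommas C → (A B : Obj) → RawFunctor (Span C A B) (Cospan C A B)
  CocommaF cc A B = record { F₀ = F₀ ; F₁ = F₁ }
    where
      F₀ : SpanObj C A B → CospanObj C A B
      F₀ S = mkCospan (CommaObj.W c) (CommaObj.p c) (CommaObj.q c)
        where c = cc (SpanObj.left S) (SpanObj.right S)

      F₁ : ∀ {S S'} → SpanHom C S S' → CospanHom C (F₀ S) (F₀ S')
      F₁ {S} {S'} h = record
        { arr = IsComma.med ic j' k' cond
        ; inl-eq = IsComma.med-p ic cond
        ; inr-eq = IsComma.med-q ic cond }
        where
          c = cc (SpanObj.left S) (SpanObj.right S)
          c' = cc (SpanObj.left S') (SpanObj.right S')
          ic = CommaObj.isComma c
          j' = CommaObj.p c'
          k' = CommaObj.q c'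
          cond : j' ∘ SpanObj.left S ≤ k' ∘ SpanObj.right S
          cond = sandwich
            (≈-trans (∘-resp-≈ ≈-refl (≈-sym (SpanHom.left-eq h))) (≈-sym assoc))
            (∘-mono (IsComma.comm (CommaObj.isComma c')) ≤-refl)
            (≈-trans assoc (∘-resp-≈ ≈-refl (SpanHom.right-eq h)))

module _ {p : Level} where
  record Mono (P Q : Poset p p p) : Set p where
    private
      module P = Poset P
      module Q = Poset Q
    field
      fun : P.Carrier → Q.Carrier
      mono : ∀ {x y} → x P.≤ y → fun x Q.≤ fun y
open Mono

Pos : (p : Level) → PosCat (lsuc p) p p
Pos p = record
  { Obj = Poset p p p
  ; _⇒_ = Mono
  ; _≤_ = λ {P} {Q} f g → ∀ x → Poset._≤_ Q (fun f x) (fun g x)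
  ; ≤-refl = λ {P} {Q} x → Poset.refl Q
  ; ≤-trans = λ {P} {Q} a b x → Poset.trans Q (a x) (b x)
  ; id = record { fun = λ x → x ; mono = λ r → r }
  ; _∘_ = λ f g → record { fun = λ x → fun f (fun g x) ; mono = λ r → mono f (mono g r) }
  ; ∘-mono = λ {A} {B} {C} {f} {f'} {g} {g'} a b x → Poset.trans C (mono f (b x)) (a (fun g' x))
  ; identityˡ = λ {A} {B} → (λ x → Poset.refl B) , (λ x → Poset.refl B)
  ; identityʳ = λ {A} {B} → (λ x → Poset.refl B) , (λ x → Poset.refl B)
  ; assoc = λ {A} {B} {C} {D} → (λ x → Poset.refl D) , (λ x → Poset.refl D)
  }

record WRel {p} (A B : Poset p p p) : Set (lsuc p) where
  private
    module A = Poset A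
    module B = Poset B
  field
    R : A.Carrier → B.Carrier → Set p
    weaken : ∀ {a a' b b'} → a' A.≤ a → R a b → b B.≤ b' → R a' b'

_≡W_ : ∀ {p} {A B : Poset p p p} → WRel A B → WRel A B → Set p
R₁ ≡W R₂ = ∀ a b → (WRel.R R₁ a b → WRel.R R₂ a b) × (WRel.R R₂ a b → WRel.R R₁ a b)

-- Cocomma ⊣ Comma is a "thin" adjunction: by the uniqueness half of the universal
-- properties, any two morphisms of spans into a comma span, or of cospans out of a
-- cocomma cospan, are equal.  Functoriality, monotonicity, the triangle laws,
-- idempotency and the correspondence of fixed points therefore hold as soon as the
-- relevant arrows exist, and they exist by the existence half.
--
-- In Pos, a span (p, q) with apex W determines the weakening relation
-- a ≤ p w ∧ q w ≤ b, and a weakening relation R determines its tabulation.  The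
-- tabulation of R is closed because the cocomma of the tabulation maps into the
-- collage of R (A ⊎ B with a ≤ b iff R a b), which reflects R; a closed span is
-- recovered from its relation because both it and the tabulation are subterminal.

module Submission where

open import Defs
open import Level using (_⊔_)
open import Data.Product using (Σ; Σ-syntax; _×_; _,_; proj₁; proj₂)
open import Data.Sum using (_⊎_; inj₁; inj₂)
open import Relation.Binary.Core using (REL) renaming (_⇒_ to _⊆_)
open import Relation.Binary.Bundles using (Poset; Setoid)
open import Relation.Binary.Definitions using (Transitive)
open import Relation.Binary.Construct.Interior.Symmetric using (poset)
import Relation.Binary.Reasoning.Setoid as SetoidReasoning

module _ {a b r s} {X : Set a} {_~_ : X → X → Set r} {Y : Set b} {_∼_ : Y → Y → Set s} where

  Bij-sym : Bij X _~_ Y _∼_ → Bij Y _∼_ X _~_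
  Bij-sym f = record
    { to = from ; from = to ; to-cong = from-cong ; from-cong = to-cong
    ; from-to = to-from ; to-from = from-to }
    where open Bij f

  Bij-trans : ∀ {c t} {Z : Set c} {_≋_ : Z → Z → Set t} →
              Transitive _~_ → Transitive _≋_ →
              Bij X _~_ Y _∼_ → Bij Y _∼_ Z _≋_ → Bij X _~_ Z _≋_
  Bij-trans ~-trans ≋-trans f g = record
    { to = λ x → g.to (f.to x)
    ; from = λ z → f.from (g.from z)
    ; to-cong = λ x~x' → g.to-cong (f.to-cong x~x')
    ; from-cong = λ z≋z' → f.from-cong (g.from-cong z≋z')
    ; from-to = λ x → ~-trans (f.from-cong (g.from-to (f.to x))) (f.from-to x)
    ; to-from = λ z → ≋-trans (g.to-cong (f.to-from (g.from z))) (g.to-from z) }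
    where
      module f = Bij f
      module g = Bij g

module PosCatLemmas {o ℓ e} (C : PosCat o ℓ e) where
  open PosCat C
  open PosCatProps C

  hom-setoid : Obj → Obj → Setoid ℓ e
  hom-setoid X Y = record
    { Carrier = X ⇒ Y ; _≈_ = _≈_
    ; isEquivalence = record { refl = ≈-refl ; sym = ≈-sym ; trans = ≈-trans } }

  module HomReasoning {X Y : Obj} = SetoidReasoning (hom-setoid X Y)
  open HomReasoning

  cancelInner : ∀ {X Y Z W} {f : X ⇒ Y} {g : Y ⇒ Z} {g' : Z ⇒ Y} {f' : Y ⇒ W} →
                g' ∘ g ≈ id → (f' ∘ g') ∘ (g ∘ f) ≈ f' ∘ f
  cancelInner {f = f} {g} {g'} {f'} g'g≈id = begin
    (f' ∘ g') ∘ (g ∘ f)  ≈⟨ assoc ⟩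
    f' ∘ (g' ∘ (g ∘ f))  ≈⟨ ∘-resp-≈ ≈-refl (≈-sym assoc) ⟩
    f' ∘ ((g' ∘ g) ∘ f)  ≈⟨ ∘-resp-≈ ≈-refl (∘-resp-≈ g'g≈id ≈-refl) ⟩
    f' ∘ (id ∘ f)        ≈⟨ ∘-resp-≈ ≈-refl identityˡ ⟩
    f' ∘ f               ∎

  Iso-trans : ∀ {X Y Z} → Iso C X Y → Iso C Y Z → Iso C X Z
  Iso-trans i j = record
    { to = Iso.to j ∘ Iso.to i
    ; isIso = record
      { inv = I.inv ∘ J.inv
      ; isoˡ = ≈-trans (cancelInner J.isoˡ) I.isoˡ
      ; isoʳ = ≈-trans (cancelInner I.isoʳ) J.isoʳ } }
    where
      module I = IsIso (Iso.isIso i)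
      module J = IsIso (Iso.isIso j)

  Subterminal : Obj → Set (o ⊔ ℓ ⊔ e)
  Subterminal X = ∀ {Z} (f g : Z ⇒ X) → f ≈ g

  Subinitial : Obj → Set (o ⊔ ℓ ⊔ e)
  Subinitial X = ∀ {Z} (f g : X ⇒ Z) → f ≈ g

  isIso-of-unique-endos : ∀ {X Y} → (∀ (h k : X ⇒ X) → h ≈ k) →
                          (∀ (h k : Y ⇒ Y) → h ≈ k) → (f : X ⇒ Y) → Y ⇒ X → IsIso C f
  isIso-of-unique-endos endoX endoY f g =
    record { inv = g ; isoˡ = endoX (g ∘ f) id ; isoʳ = endoY (f ∘ g) id }

  iso-of-unique-endos : ∀ {X Y} → (∀ (h k : X ⇒ X) → h ≈ k) →
                        (∀ (h k : Y ⇒ Y) → h ≈ k) → X ⇒ Y → Y ⇒ X → Iso C X Y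
  iso-of-unique-endos endoX endoY f g =
    record { to = f ; isIso = isIso-of-unique-endos endoX endoY f g }

  Subterminal-resp-Iso : ∀ {X Y} → Iso C X Y → Subterminal X → Subterminal Y
  Subterminal-resp-Iso i subX f g = begin
    f                  ≈⟨ ≈-sym identityˡ ⟩
    id ∘ f             ≈⟨ ∘-resp-≈ (≈-sym isoʳ) ≈-refl ⟩
    (to ∘ inv) ∘ f     ≈⟨ assoc ⟩
    to ∘ (inv ∘ f)     ≈⟨ ∘-resp-≈ ≈-refl (subX (inv ∘ f) (inv ∘ g)) ⟩
    to ∘ (inv ∘ g)     ≈⟨ ≈-sym assoc ⟩
    (to ∘ inv) ∘ g     ≈⟨ ∘-resp-≈ isoʳ ≈-refl ⟩
    id ∘ g             ≈⟨ identityˡ ⟩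
    g                  ∎
    where
      open Iso i using (to)
      open IsIso (Iso.isIso i)

  IsComma-jointlyMonic : ∀ {A B X W Y} {j : A ⇒ X} {k : B ⇒ X} {p : W ⇒ A} {q : W ⇒ B} →
                         IsComma C j k p q → {h₁ h₂ : Y ⇒ W} →
                         p ∘ h₁ ≈ p ∘ h₂ → q ∘ h₁ ≈ q ∘ h₂ → h₁ ≈ h₂
  IsComma-jointlyMonic {j = j} {k} {p} {q} isComma {h₁} {h₂} ph≈ph qh≈qh =
    ≈-trans (unique comm₁ h₁ ≈-refl ≈-refl)
            (≈-sym (unique comm₁ h₂ (≈-sym ph≈ph) (≈-sym qh≈qh)))
    where
      open IsComma isComma
      comm₁ : j ∘ (p ∘ h₁) ≤ k ∘ (q ∘ h₁)
      comm₁ = ≤-trans (proj₂ assoc) (≤-trans (∘-mono comm ≤-refl) (proj₁ assoc))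

  comma-spanHom : ∀ {A B X W} {j : A ⇒ X} {k : B ⇒ X} {p : W ⇒ A} {q : W ⇒ B} →
                  IsComma C j k p q → (S : SpanObj C A B) →
                  j ∘ SpanObj.left S ≤ k ∘ SpanObj.right S → SpanHom C S (mkSpan W p q)
  comma-spanHom isComma (mkSpan _ l r) square = record
    { arr = med l r square ; left-eq = med-p square ; right-eq = med-q square }
    where open IsComma isComma

  cocomma-cospanHom : ∀ {A B X W} {l : X ⇒ A} {r : X ⇒ B} {i : A ⇒ W} {i' : B ⇒ W} →
                      IsComma (op C) l r i i' → (K : CospanObj C A B) →
                      CospanObj.inl K ∘ l ≤ CospanObj.inr K ∘ r → CospanHom C (mkCospan W i i') K
  cocomma-cospanHom isCocomma (mkCospan _ j k) square = record
    { arr = med j k square ; inl-eq = med-p square ; inr-eq = med-q square }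
    where open IsComma isCocomma

open PosCatLemmas public
  using ( Iso-trans; Subterminal; Subinitial; isIso-of-unique-endos; iso-of-unique-endos
        ; Subterminal-resp-Iso; IsComma-jointlyMonic; comma-spanHom; cocomma-cospanHom )

module _ {o ℓ e o' ℓ' e'} {C : PosCat o ℓ e} {D : PosCat o' ℓ' e'} (F : RawFunctor C D) where
  open RawFunctor F

  isPosFunctor-into-subterminals : (∀ X → Subterminal D (F₀ X)) → IsPosFunctor F
  isPosFunctor-into-subterminals sub = record
    { F-id = sub _ _ _ ; F-∘ = λ _ _ → sub _ _ _ ; F-mono = λ _ → proj₁ (sub _ _ _) }

  isPosFunctor-into-subinitials : (∀ X → Subinitial D (F₀ X)) → IsPosFunctor F
  isPosFunctor-into-subinitials sub = record
    { F-id = sub _ _ _ ; F-∘ = λ _ _ → sub _ _ _ ; F-mono = λ _ → proj₁ (sub _ _ _) }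

module ThinAdjunction
  {o ℓ e o' ℓ' e'} {C : PosCat o ℓ e} {D : PosCat o' ℓ' e'}
  (F : RawFunctor C D) (G : RawFunctor D C)
  (unit : ∀ X → PosCat._⇒_ C X (RawFunctor.F₀ (G ∘F F) X))
  (counit : ∀ Y → PosCat._⇒_ D (RawFunctor.F₀ (F ∘F G) Y) Y)
  (G-subterminal : ∀ Y → Subterminal C (RawFunctor.F₀ G Y))
  (F-subinitial : ∀ X → Subinitial D (RawFunctor.F₀ F X))
  where
  private
    module F = RawFunctor F
    module G = RawFunctor G

  F-isPosFunctor : IsPosFunctor F
  F-isPosFunctor = isPosFunctor-into-subinitials F F-subinitial

  G-isPosFunctor : IsPosFunctor G
  G-isPosFunctor = isPosFunctor-into-subterminals G G-subterminal

  adjunction : Adjunction F G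
  adjunction = record
    { η = unit
    ; ε = counit
    ; η-nat = λ _ → G-subterminal _ _ _
    ; ε-nat = λ _ → F-subinitial _ _ _
    ; zig = λ _ → F-subinitial _ _ _
    ; zag = λ _ → G-subterminal _ _ _ }

  idempotentMonad : IdempotentMonad adjunction
  idempotentMonad X =
    isIso-of-unique-endos C (G-subterminal _) (G-subterminal _) _ (unit (G.F₀ (F.F₀ X)))

  idempotentComonad : IdempotentComonad adjunction
  idempotentComonad Y =
    isIso-of-unique-endos D (F-subinitial _) (F-subinitial _) _ (counit (F.F₀ (G.F₀ Y)))

  GFG≅G : ∀ Y → Iso C (G.F₀ (F.F₀ (G.F₀ Y))) (G.F₀ Y)
  GFG≅G Y = iso-of-unique-endos C (G-subterminal _) (G-subterminal _)
                                (G.F₁ (counit Y)) (unit (G.F₀ Y))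

  FGF≅F : ∀ X → Iso D (F.F₀ (G.F₀ (F.F₀ X))) (F.F₀ X)
  FGF≅F X = iso-of-unique-endos D (F-subinitial _) (F-subinitial _)
                                (counit (F.F₀ X)) (F.F₁ (unit X))

  closureOp : ClosureOp C (G ∘F F)
  closureOp = record
    { monotone = isPosFunctor-into-subterminals (G ∘F F) (λ X → G-subterminal (F.F₀ X))
    ; extensive = unit
    ; idempotent = λ X → GFG≅G (F.F₀ X) }

  interiorOp : InteriorOp D (F ∘F G)
  interiorOp = record
    { monotone = isPosFunctor-into-subinitials (F ∘F G) (λ Y → F-subinitial (G.F₀ Y))
    ; deflationary = counit
    ; idempotent = λ Y → FGF≅F (G.F₀ Y) }

  Fix-GF↔Fix-FG : Bij (Fix C (G ∘F F)) (FixIso C (G ∘F F)) (Fix D (F ∘F G)) (FixIso D (F ∘F G))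
  Fix-GF↔Fix-FG = record
    { to = λ (X , _) → F.F₀ X , FGF≅F X
    ; from = λ (Y , _) → G.F₀ Y , GFG≅G Y
    ; to-cong = λ X≅X' → iso-of-unique-endos D (F-subinitial _) (F-subinitial _)
                           (F.F₁ (Iso.to X≅X')) (F.F₁ (IsIso.inv (Iso.isIso X≅X')))
    ; from-cong = λ Y≅Y' → iso-of-unique-endos C (G-subterminal _) (G-subterminal _)
                             (G.F₁ (Iso.to Y≅Y')) (G.F₁ (IsIso.inv (Iso.isIso Y≅Y')))
    ; from-to = proj₂
    ; to-from = proj₂ }

module CommaCocomma
  {o ℓ e} (C : PosCat o ℓ e) (cm : HasCommas C) (cc : HasCocommas C) (A B : PosCat.Obj C) where
  open PosCat C
  open PosCatProps C

  Cocomma : RawFunctor (Span C A B) (Cospan C A B)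
  Cocomma = CocommaF C cc A B

  Comma : RawFunctor (Cospan C A B) (Span C A B)
  Comma = CommaF C cm A B

  open RawFunctor Cocomma using () renaming (F₀ to Cocomma₀)
  open RawFunctor Comma using () renaming (F₀ to Comma₀)
  open SpanObj
  open CospanObj
  open SpanHom
  open CospanHom

  Comma-subterminal : ∀ K → Subterminal (Span C A B) (Comma₀ K)
  Comma-subterminal K f g =
    IsComma-jointlyMonic C (CommaObj.isComma (cm (inl K) (inr K)))
    (≈-trans (left-eq f) (≈-sym (left-eq g))) (≈-trans (right-eq f) (≈-sym (right-eq g)))

  Cocomma-subinitial : ∀ S → Subinitial (Cospan C A B) (Cocomma₀ S)
  Cocomma-subinitial S f g =
    IsComma-jointlyMonic (op C) (CommaObj.isComma (cc (left S) (right S)))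
    (≈-trans (inl-eq f) (≈-sym (inl-eq g))) (≈-trans (inr-eq f) (≈-sym (inr-eq g)))

  unit : ∀ S → SpanHom C S (Comma₀ (Cocomma₀ S))
  unit S = comma-spanHom C (CommaObj.isComma (cm _ _)) S (IsComma.comm (CommaObj.isComma (cc _ _)))

  counit : ∀ K → CospanHom C (Cocomma₀ (Comma₀ K)) K
  counit K =
    cocomma-cospanHom C (CommaObj.isComma (cc _ _)) K (IsComma.comm (CommaObj.isComma (cm _ _)))

  open ThinAdjunction Cocomma Comma unit counit Comma-subterminal Cocomma-subinitial public

module _ {p} {A B : Poset p p p} where
  private
    module A = Poset A
    module B = Poset B
  open Mono
  open SpanObj
  open SpanHom

  module _ (R : REL (Poset.Carrier A) (Poset.Carrier B) p) where

    Graph : Set p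
    Graph = Σ[ a ∈ A.Carrier ] Σ[ b ∈ B.Carrier ] R a b

    _≤ᴳ_ : Graph → Graph → Set p
    (a , b , _) ≤ᴳ (a' , b' , _) = a A.≤ a' × b B.≤ b'

    tabulation : SpanObj (Pos p) A B
    tabulation = mkSpan graph
                        (record { fun = proj₁ ; mono = proj₁ })
                        (record { fun = λ (_ , b , _) → b ; mono = proj₂ })
      where
        graph : Poset p p p
        graph = poset {R = _≤ᴳ_} (A.refl , B.refl)
                      (λ (a≤ , b≤) (a≤' , b≤') → A.trans a≤ a≤' , B.trans b≤ b≤')

    tabulation-subterminal : Subterminal (Span (Pos p) A B) tabulation
    tabulation-subterminal f g = ≤-pointwise f g , ≤-pointwise g f
      where
        ≤-pointwise : ∀ {Z} (f g : SpanHom (Pos p) Z tabulation) →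
                      ∀ z → fun (arr f) z ≤ᴳ fun (arr g) z
        ≤-pointwise f g z = A.trans (proj₁ (left-eq f) z) (proj₂ (left-eq g) z)
                          , B.trans (proj₁ (right-eq f) z) (proj₂ (right-eq g) z)

    tabulation-intro : (S : SpanObj (Pos p) A B) → (∀ w → R (fun (left S) w) (fun (right S) w)) →
                       SpanHom (Pos p) S tabulation
    tabulation-intro S r = record
      { arr = record { fun = λ w → fun (left S) w , fun (right S) w , r w
                     ; mono = λ w≤w' → mono (left S) w≤w' , mono (right S) w≤w' }
      ; left-eq = (λ _ → A.refl) , (λ _ → A.refl)
      ; right-eq = (λ _ → B.refl) , (λ _ → B.refl) }

  spanWRel : SpanObj (Pos p) A B → WRel A B
  spanWRel S = record
    { R = λ a b → Σ[ w ∈ Poset.Carrier (apex S) ] a A.≤ fun (left S) w × fun (right S) w B.≤ b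
    ; weaken = λ a'≤a (w , a≤ , ≤b) b≤b' → w , A.trans a'≤a a≤ , B.trans ≤b b≤b' }

  spanWRel-mono : ∀ {S S'} → SpanHom (Pos p) S S' → WRel.R (spanWRel S) ⊆ WRel.R (spanWRel S')
  spanWRel-mono f (w , a≤ , ≤b) =
    fun (arr f) w , A.trans a≤ (proj₂ (left-eq f) w) , B.trans (proj₁ (right-eq f) w) ≤b

  spanWRel-tabulation : ∀ W → spanWRel (tabulation (WRel.R W)) ≡W W
  spanWRel-tabulation W a b = (λ ((_ , _ , r) , a≤ , ≤b) → WRel.weaken W a≤ r ≤b)
                            , (λ r → (a , b , r) , A.refl , B.refl)

  ≡W-trans : {W₁ W₂ W₃ : WRel A B} → W₁ ≡W W₂ → W₂ ≡W W₃ → W₁ ≡W W₃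
  ≡W-trans W₁≡W₂ W₂≡W₃ a b = (λ r → proj₁ (W₂≡W₃ a b) (proj₁ (W₁≡W₂ a b) r))
                           , (λ r → proj₂ (W₁≡W₂ a b) (proj₂ (W₂≡W₃ a b) r))

  tabulation-spanWRel : ∀ S → SpanHom (Pos p) S (tabulation (WRel.R (spanWRel S)))
  tabulation-spanWRel S = tabulation-intro _ S (λ w → w , A.refl , B.refl)

module Collage {p} {A B : Poset p p p} (W : WRel A B) where
  private
    module A = Poset A
    module B = Poset B
  open WRel W

  data _≤_ : A.Carrier ⊎ B.Carrier → A.Carrier ⊎ B.Carrier → Set p where
    inj₁≤inj₁ : ∀ {a a'} → a A.≤ a' → inj₁ a ≤ inj₁ a'
    inj₂≤inj₂ : ∀ {b b'} → b B.≤ b' → inj₂ b ≤ inj₂ b'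
    inj₁≤inj₂ : ∀ {a b} → R a b → inj₁ a ≤ inj₂ b

  ≤-refl : ∀ {x} → x ≤ x
  ≤-refl {inj₁ _} = inj₁≤inj₁ A.refl
  ≤-refl {inj₂ _} = inj₂≤inj₂ B.refl

  ≤-trans : ∀ {x y z} → x ≤ y → y ≤ z → x ≤ z
  ≤-trans (inj₁≤inj₁ a≤a') (inj₁≤inj₁ a'≤a'') = inj₁≤inj₁ (A.trans a≤a' a'≤a'')
  ≤-trans (inj₁≤inj₁ a≤a') (inj₁≤inj₂ r) = inj₁≤inj₂ (weaken a≤a' r B.refl)
  ≤-trans (inj₂≤inj₂ b≤b') (inj₂≤inj₂ b'≤b'') = inj₂≤inj₂ (B.trans b≤b' b'≤b'')
  ≤-trans (inj₁≤inj₂ r) (inj₂≤inj₂ b≤b') = inj₁≤inj₂ (weaken A.refl r b≤b')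

  inj₁≤inj₂⁻¹ : ∀ {a b} → inj₁ a ≤ inj₂ b → R a b
  inj₁≤inj₂⁻¹ (inj₁≤inj₂ r) = r

  collage : CospanObj (Pos p) A B
  collage = mkCospan (poset {R = _≤_} ≤-refl ≤-trans)
                     (record { fun = inj₁ ; mono = inj₁≤inj₁ })
                     (record { fun = inj₂ ; mono = inj₂≤inj₂ })

module PosWeakening {p} (cm : HasCommas (Pos p)) (cc : HasCocommas (Pos p)) (A B : Poset p p p) where
  open CommaCocomma (Pos p) cm cc A B
  open RawFunctor Cocomma using () renaming (F₀ to Cocomma₀)
  open RawFunctor Comma using () renaming (F₀ to Comma₀)
  open PosCat (Span (Pos p) A B) using (_∘_)
  open Mono
  open SpanObj
  open CospanObj
  open CospanHom

  private
    Spans = Span (Pos p) A B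
    Cospans = Cospan (Pos p) A B

  cocomma-tabulation-reflects : (W : WRel A B) → let K = Cocomma₀ (tabulation (WRel.R W)) in
    ∀ {a b} → Poset._≤_ (apex K) (fun (inl K) a) (fun (inr K) b) → WRel.R W a b
  cocomma-tabulation-reflects W {a} {b} ia≤ib =
    inj₁≤inj₂⁻¹ (≤-trans (proj₂ (inl-eq h) a)
                         (≤-trans (mono (arr h) ia≤ib) (proj₁ (inr-eq h) b)))
    where
      open Collage W
      h : CospanHom (Pos p) (Cocomma₀ (tabulation (WRel.R W))) collage
      h = cocomma-cospanHom (Pos p) (CommaObj.isComma (cc _ _)) collage λ (_ , _ , r) → inj₁≤inj₂ r

  tabulation-fixed : ∀ W → let T = tabulation (WRel.R W) in Iso Spans (Comma₀ (Cocomma₀ T)) T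
  tabulation-fixed W = iso-of-unique-endos Spans (Comma-subterminal _) (tabulation-subterminal _)
    (tabulation-intro _ _ λ w →
      cocomma-tabulation-reflects W (IsComma.comm (CommaObj.isComma (cm _ _)) w))
    (unit _)

  tabulation-spanWRel⇒closure : ∀ S →
    SpanHom (Pos p) (tabulation (WRel.R (spanWRel S))) (Comma₀ (Cocomma₀ S))
  tabulation-spanWRel⇒closure S = comma-spanHom (Pos p) (CommaObj.isComma (cm _ _)) _ square
    where
      K = Cocomma₀ S
      module K = Poset (apex K)
      square : ∀ x → fun (inl K) (proj₁ x) K.≤ fun (inr K) (proj₁ (proj₂ x))
      square (_ , _ , w , a≤ , ≤b) =
        K.trans (mono (inl K) a≤)
                (K.trans (IsComma.comm (CommaObj.isComma (cc _ _)) w) (mono (inr K) ≤b))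

  Fix-Span↔WRel : Bij (Fix Spans (Comma ∘F Cocomma)) (FixIso Spans (Comma ∘F Cocomma)) (WRel A B) _≡W_
  Fix-Span↔WRel = record
    { to = λ (S , _) → spanWRel S
    ; from = λ W → tabulation (WRel.R W) , tabulation-fixed W
    ; to-cong = λ S≅S' _ _ →
        spanWRel-mono (Iso.to S≅S') , spanWRel-mono (IsIso.inv (Iso.isIso S≅S'))
    ; from-cong = λ W≡W' →
        iso-of-unique-endos Spans (tabulation-subterminal _) (tabulation-subterminal _)
        (tabulation-intro _ _ λ (a , b , r) → proj₁ (W≡W' a b) r)
        (tabulation-intro _ _ λ (a , b , r) → proj₂ (W≡W' a b) r)
    ; from-to = λ (S , GFS≅S) → iso-of-unique-endos Spans (tabulation-subterminal _)
        (Subterminal-resp-Iso Spans GFS≅S (Comma-subterminal _))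
        (Iso.to GFS≅S ∘ tabulation-spanWRel⇒closure S) (tabulation-spanWRel S)
    ; to-from = spanWRel-tabulation }

  Fix-Cospan↔WRel : Bij (Fix Cospans (Cocomma ∘F Comma)) (FixIso Cospans (Cocomma ∘F Comma))
                        (WRel A B) _≡W_
  Fix-Cospan↔WRel =
    -- _≡W_ is not injective, so the relata of ≡W-trans have to be passed explicitly.
    Bij-trans (Iso-trans Cospans) (λ {W₁ W₂ W₃} → ≡W-trans {W₁ = W₁} {W₂} {W₃})
              (Bij-sym Fix-GF↔Fix-FG) Fix-Span↔WRel

proposition3p2 :
    ∀ {o ℓ e p} →
    -- general part: any Pos-category with chosen commas and cocommas
    (∀ (C : PosCat o ℓ e) (cm : HasCommas C) (cc : HasCocommas C) (A B : PosCat.Obj C) →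
      IsPosFunctor (CocommaF C cc A B)
      × IsPosFunctor (CommaF C cm A B)
      × Σ (Adjunction (CocommaF C cc A B) (CommaF C cm A B))
          (λ adj → IdempotentMonad adj × IdempotentComonad adj)
      × ClosureOp (Span C A B) (CommaF C cm A B ∘F CocommaF C cc A B)
      × InteriorOp (Cospan C A B) (CocommaF C cc A B ∘F CommaF C cm A B)
      × Bij (Fix (Span C A B) (CommaF C cm A B ∘F CocommaF C cc A B)) (FixIso (Span C A B) (CommaF C cm A B ∘F CocommaF C cc A B))
            (Fix (Cospan C A B) (CocommaF C cc A B ∘F CommaF C cm A B)) (FixIso (Cospan C A B) (CocommaF C cc A B ∘F CommaF C cm A B)))
    ×
    -- the case C = Pos
    (∀ (cm : HasCommas (Pos p)) (cc : HasCocommas (Pos p)) (A B : PosCat.Obj (Pos p)) →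
      Bij (Fix (Span (Pos p) A B) (CommaF (Pos p) cm A B ∘F CocommaF (Pos p) cc A B))
          (FixIso (Span (Pos p) A B) (CommaF (Pos p) cm A B ∘F CocommaF (Pos p) cc A B))
          (WRel A B) _≡W_
      × Bij (Fix (Cospan (Pos p) A B) (CocommaF (Pos p) cc A B ∘F CommaF (Pos p) cm A B))
          (FixIso (Cospan (Pos p) A B) (CocommaF (Pos p) cc A B ∘F CommaF (Pos p) cm A B))
          (WRel A B) _≡W_)
proposition3p2 =
  (λ C cm cc A B → let open CommaCocomma C cm cc A B in
    F-isPosFunctor , G-isPosFunctor , (adjunction , idempotentMonad , idempotentComonad)
    , closureOp , interiorOp , Fix-GF↔Fix-FG)
  , λ cm cc A B → let open PosWeakening cm cc A B in Fix-Span↔WRel , Fix-Cospan↔WRel
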